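{- Let $k,\ell\ge0$, let $T$ be a set of $t\ge1$ positive integers, and let $\pi=\pi_0\pi_1\cdots\pi_t$ with $\pi_0=0$ and $\pi_1\cdots\pi_t$ a permutation of $T$. The number of contained $(k,\ell)$-pullback $(t,t)$-parking functions for the cars of $T$ whose outcome is $\pi$ equals \[ \prod_{i=1}^{t}\bigl[\mathrm{B}(\pi_i)+\mathrm{F}(\pi_i)+1\bigr],\qquad \mathrm{B}(\pi_i)=\min(\mathrm{Right}(\pi_i),k),\quad \mathrm{F}(\pi_i)=\max(\min(\mathrm{Left}(\pi_i)-k,\ell),0). \]
   Context: $(k,\ell)$-pullback parking rule: a car with preference $a$ parks in spot $a$ if it is empty; otherwise it checks spots $a-1,\dots,a-k$ in order (not below the first spot of the street) and parks in the first empty one; if none, it checks spots $a+1,\dots,a+\ell$ in order (not beyond the last spot) and parks in the first empty one; otherwise it fails. Contained parking functions for the cars of $T$: the cars of $T$ enter in increasing order of label, with preferences $(a_c)_{c\in T}\in[t]^T$, on a street with spots $0,1,\dots,t$ where spot $0$ is an extra initially empty spot; the preference list is a contained $(k,\ell)$-pullback $(t,t)$-parking function if all cars park in spots $1,\dots,t$ and no car backs into spot $0$. Its outcome is $\pi_0\pi_1\cdots\pi_t$ with $\pi_0=0$ and $\pi_u$ the car parked in spot $u$. $\mathrm{Right}(\pi_i)$ is the largest $x\ge0$ with $\pi_y<\pi_i$ for all $i+1\le y\le i+x\le t$; $\mathrm{Left}(\pi_i)$ is the largest $x\ge0$ with $0<\pi_z<\pi_i$ for all $1\le i-x\le z\le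 i-1$. -}

module Defs where

open import Data.Nat using (ℕ; zero; suc; _+_; _∸_; _≤?_; _<ᵇ_; _≡ᵇ_; _⊓_)
import Data.Nat.Properties as ℕP
open import Data.Bool using (Bool; true; false; if_then_else_; _∧_)
open import Data.Fin using (Fin; toℕ)
open import Data.List using (List; []; _∷_; map; filter; length; upTo; zip; take; drop; reverse; _++_; concatMap; allFin)
import Data.List.Properties as LP
open import Data.Nat.ListAction using (product)
open import Data.Vec using (Vec; toList)
import Data.Vec as V
open import Data.Maybe using (Maybe; just; nothing; is-nothing)
import Data.Maybe as M
import Data.Maybe.Properties as MP
open import Data.Product using (_×_; _,_)
open import Relation.Binary.PropositionalEquality using (_≡_)
open import Relation.Nullary using (Dec)

-- A street with spots 0,1,2,... : spot ↦ car parked there (if any).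
Street : Set
Street = ℕ → Maybe ℕ

emptyStreet : Street
emptyStreet _ = nothing

oneTo : ℕ → List ℕ
oneTo n = map suc (upTo n)

-- Spots a car with preference a checks, in order, under the (k,ℓ)-pullback
-- rule on the street with spots 0..t:  a, a-1, ..., a-k (not below spot 0),
-- then a+1, ..., a+ℓ (not beyond spot t).
candidates : (k ℓ t a : ℕ) → List ℕ
candidates k ℓ t a =
  a ∷ (map (a ∸_) (filter (_≤? a) (oneTo k))
       ++ filter (_≤? t) (map (a +_) (oneTo ℓ)))

firstEmpty : Street → List ℕ → Maybe ℕ
firstEmpty st [] = nothing
firstEmpty st (s ∷ ss) = if is-nothing (st s) then just s else firstEmpty st ss

place : Street → ℕ → ℕ → Street
place st s c s' = if s' ≡ᵇ s then just c else st s'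

-- One car c with preference a enters.  Returns nothing if the car fails to
-- park or backs into the extra spot 0 (both violate containment).
parkCar : (k ℓ t : ℕ) → Street → ℕ × ℕ → Maybe Street
parkCar k ℓ t st (c , a) with firstEmpty st (candidates k ℓ t a)
... | nothing = nothing
... | just zero = nothing
... | just (suc s) = just (place st (suc s) c)

parkAll : (k ℓ t : ℕ) → Street → List (ℕ × ℕ) → Maybe Street
parkAll k ℓ t st [] = just st
parkAll k ℓ t st (ca ∷ cas) with parkCar k ℓ t st ca
... | nothing = nothing
... | just st' = parkAll k ℓ t st' cas

-- Cars of T given as strictly increasing vector (entry order); the preference
-- of the i-th car is suc (toℕ (p i)) ∈ [t].  Result: nothing if the list is
-- not a contained (k,ℓ)-pullback (t,t)-parking function; otherwise the
-- contents of spots 1..t.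
outcome : (k ℓ : ℕ) {t : ℕ} → Vec ℕ t → Vec (Fin t) t → Maybe (List (Maybe ℕ))
outcome k ℓ {t} T p =
  M.map (λ st → map st (oneTo t))
        (parkAll k ℓ t emptyStreet
                 (zip (toList T) (map (λ i → suc (toℕ i)) (toList p))))

allVecs : (n m : ℕ) → List (Vec (Fin m) n)
allVecs zero m = V.[] ∷ []
allVecs (suc n) m = concatMap (λ x → map (x V.∷_) (allVecs n m)) (allFin m)

-- The outcome π_1 ... π_t (π_0 = 0 implicit) as required list of spot contents.
isOutcome : (k ℓ : ℕ) {t : ℕ} (T : Vec ℕ t) (π : Vec ℕ t) (p : Vec (Fin t) t) →
            Dec (outcome k ℓ T p ≡ just (map just (toList π)))
isOutcome k ℓ T π p =
  MP.≡-dec (LP.≡-dec (MP.≡-dec ℕP._≟_)) (outcome k ℓ T p) (just (map just (toList π)))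

countPF : (k ℓ : ℕ) {t : ℕ} (T : Vec ℕ t) (π : Vec ℕ t) → ℕ
countPF k ℓ {t} T π = length (filter (isOutcome k ℓ T π) (allVecs t t))

leadingRun : (ℕ → Bool) → List ℕ → ℕ
leadingRun p [] = 0
leadingRun p (x ∷ xs) = if p x then suc (leadingRun p xs) else 0

-- For position j (0-based index into π_1..π_t, i.e. spot i = j+1):
-- Right(π_i): run of entries π_{i+1}, π_{i+2}, ... smaller than π_i.
Right : {t : ℕ} → Vec ℕ t → Fin t → ℕ
Right π j = leadingRun (_<ᵇ V.lookup π j) (drop (suc (toℕ j)) (toList π))

Left : {t : ℕ} → Vec ℕ t → Fin t → ℕ
Left π j = leadingRun (λ z → (0 <ᵇ z) ∧ (z <ᵇ V.lookup π j))
                      (reverse (0 ∷ take (toℕ j) (toList π)))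

B : (k : ℕ) {t : ℕ} → Vec ℕ t → Fin t → ℕ
B k π j = Right π j ⊓ k

-- F(π_i) = max(min(Left(π_i) - k, ℓ), 0), computed in ℕ with truncated
-- subtraction (equal to the integer formula).
F : (k ℓ : ℕ) {t : ℕ} → Vec ℕ t → Fin t → ℕ
F k ℓ π j = (Left π j ∸ k) ⊓ ℓ

productFormula : (k ℓ : ℕ) {t : ℕ} → Vec ℕ t → ℕ
productFormula k ℓ {t} π = product (map (λ j → B k π j + F k ℓ π j + 1) (allFin t))

{-# OPTIONS --safe #-}
module Submission where

-- Cars never move once parked and enter in increasing order, so a preference
-- list has outcome π exactly when every car c lands directly on its final spot i
-- (π_i = c), and then, just before c enters, the occupied spots are exactly those
-- whose final car is smaller than c.  In that street the block of occupied spots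
-- right after i has length Right(π_i), and the block left of i, which always
-- stops at the empty spot 0, has length Left(π_i).  By the pullback rule, c lands
-- on i iff its preference a satisfies i - F ≤ a ≤ i + B: either c backs up from a
-- through full spots (at most k of them), or the k spots behind a are full and c
-- drives forward (at most ℓ spots).  So c has B + F + 1 admissible preferences
-- whatever the other cars do, and the count is the product.

open import Defs

open import Data.Bool using (Bool; true; false; T; if_then_else_; _∧_)
open import Data.Bool.Properties using (T-≡; T-∧)
open import Data.Empty using (⊥-elim)
open import Data.Fin using (Fin; toℕ)
import Data.Fin as Fin
import Data.Fin.Properties as Fin
open import Data.List
  using (List; []; _∷_; _++_; map; filter; length; upTo; applyUpTo; tabulate; allFin; drop; take; reverse; concatMap; zip)
import Data.List.Properties as LP
open import Data.List.Membership.Propositional using (_∈_; _∉_)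
open import Data.List.Membership.Propositional.Properties using (∈-map⁺; ∈-upTo⁺)
open import Data.List.Relation.Unary.All using (All)
import Data.List.Relation.Unary.All as All
import Data.List.Relation.Unary.All.Properties as All
open import Data.List.Relation.Unary.AllPairs using (AllPairs; _∷_)
import Data.List.Relation.Unary.AllPairs as AllPairs
open import Data.List.Relation.Unary.Any using (here; there)
open import Data.List.Relation.Unary.Linked using (Linked)
open import Data.List.Relation.Unary.Linked.Properties using (Linked⇒AllPairs)
open import Data.List.Relation.Binary.Permutation.Propositional using (_↭_; ↭-sym; ↭⇒↭ₛ)
import Data.List.Relation.Binary.Permutation.Propositional.Properties as ↭
import Data.List.Relation.Binary.Permutation.Setoid.Properties as ↭ₛ
open import Data.Maybe using (Maybe; just; nothing; Is-just; _<∣>_; _>>=_)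
import Data.Maybe as M
import Data.Maybe.Properties as MP
open import Data.Maybe.Relation.Unary.Any using (Any; just; drop-just)
import Data.Maybe.Relation.Unary.Any as Any
open import Data.Nat
  using (ℕ; zero; suc; _+_; _*_; _∸_; _⊓_; _<_; _≤_; _≤?_; _<?_; _≟_; _≡ᵇ_; _<ᵇ_; z≤n; s≤s; z<s; s<s)
open import Data.Nat.ListAction using (sum; product)
open import Data.Nat.ListAction.Properties using (product-↭)
open import Data.Nat.Properties
open import Data.Nat.Solver using (module +-*-Solver)
open import Data.List.Membership.DecPropositional _≟_ using (_∈?_)
open import Data.Product using (_×_; _,_; proj₁; proj₂)
import Data.Product as Product
open import Data.Sum using (_⊎_; inj₁; inj₂)
open import Data.Vec using (Vec; toList)
import Data.Vec as V
import Data.Vec.Properties as V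
open import Function using (_∘_; id; _⇔_; mk⇔; Equivalence)
open Equivalence using (to; from)
open import Relation.Binary.Definitions using (DecidableEquality; tri<; tri≈; tri>)
open import Relation.Binary.PropositionalEquality
open import Relation.Nullary using (¬_; Dec; yes; no; does; contradiction)
open import Relation.Nullary.Decidable using (dec-true; dec-false)
open import Relation.Unary using (Decidable)

private variable
  A A′ : Set
  n r : ℕ

nth : List A → ℕ → Maybe A
nth []       _       = nothing
nth (x ∷ xs) zero    = just x
nth (x ∷ xs) (suc r) = nth xs r

nth-drop : ∀ n (xs : List A) r → nth (drop n xs) r ≡ nth xs (n + r)
nth-drop zero    xs       r = refl
nth-drop (suc n) []       r = refl
nth-drop (suc n) (x ∷ xs) r = nth-drop n xs r

nth-take : ∀ n (xs : List A) {r} → r < n → nth (take n xs) r ≡ nth xs r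
nth-take (suc n) []       _                 = refl
nth-take (suc n) (x ∷ xs) {zero}  _         = refl
nth-take (suc n) (x ∷ xs) {suc r} (s<s r<n) = nth-take n xs r<n

nth-++ˡ : ∀ (xs ys : List A) {r} → r < length xs → nth (xs ++ ys) r ≡ nth xs r
nth-++ˡ (x ∷ xs) ys {zero}  _         = refl
nth-++ˡ (x ∷ xs) ys {suc r} (s<s r<n) = nth-++ˡ xs ys r<n

nth-++-length : ∀ (xs ys : List A) → nth (xs ++ ys) (length xs) ≡ nth ys 0
nth-++-length []       ys = refl
nth-++-length (x ∷ xs) ys = nth-++-length xs ys

nth-reverse : ∀ (xs : List A) → r < length xs → nth (reverse xs) r ≡ nth xs (length xs ∸ suc r)
nth-reverse {r = r} (x ∷ xs) r≤n rewrite LP.unfold-reverse x xs with m≤n⇒m<n∨m≡n (≤-pred r≤n)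
... | inj₁ r<n = begin
  nth (reverse xs ++ x ∷ []) r  ≡⟨ nth-++ˡ (reverse xs) _ (subst (r <_) (sym (LP.length-reverse xs)) r<n) ⟩
  nth (reverse xs) r            ≡⟨ nth-reverse xs r<n ⟩
  nth xs (length xs ∸ suc r)    ≡⟨ cong (nth (x ∷ xs)) (+-∸-assoc 1 r<n) ⟨
  nth (x ∷ xs) (length xs ∸ r)  ∎
  where open ≡-Reasoning
... | inj₂ refl = begin
  nth (reverse xs ++ x ∷ []) r                      ≡⟨ cong (nth (reverse xs ++ x ∷ [])) (LP.length-reverse xs) ⟨
  nth (reverse xs ++ x ∷ []) (length (reverse xs))  ≡⟨ nth-++-length (reverse xs) _ ⟩
  just x                                            ≡⟨ cong (nth (x ∷ xs)) (n∸n≡0 r) ⟨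
  nth (x ∷ xs) (r ∸ r)                              ∎
  where open ≡-Reasoning

nth-∈ : ∀ (xs : List A) r {x} → nth xs r ≡ just x → x ∈ xs
nth-∈ (x ∷ xs) zero    refl = here refl
nth-∈ (x ∷ xs) (suc r) eq   = there (nth-∈ xs r eq)

nth-≥ : ∀ (xs : List A) → length xs ≤ r → nth xs r ≡ nothing
nth-≥ []       _         = refl
nth-≥ (x ∷ xs) (s≤s n≤r) = nth-≥ xs n≤r

nth-injective : ∀ {xs : List A} → AllPairs _≢_ xs →
  ∀ a b {x} → nth xs a ≡ just x → nth xs b ≡ just x → a ≡ b
nth-injective {xs = x ∷ xs} _         zero    zero    _    _    = refl
nth-injective {xs = x ∷ xs} (x∉ ∷ _)  zero    (suc b) refl eb   = contradiction refl (All.lookup x∉ (nth-∈ xs b eb))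
nth-injective {xs = x ∷ xs} (x∉ ∷ _)  (suc a) zero    ea   refl = contradiction refl (All.lookup x∉ (nth-∈ xs a ea))
nth-injective {xs = x ∷ xs} (_ ∷ dis) (suc a) (suc b) ea   eb   = cong suc (nth-injective dis a b ea eb)

map-nth-upTo : ∀ (xs : List A) → map (nth xs) (upTo (length xs)) ≡ map just xs
map-nth-upTo []       = refl
map-nth-upTo (x ∷ xs) = cong (just x ∷_) (begin
  map (nth (x ∷ xs)) (applyUpTo suc (length xs))  ≡⟨ LP.map-applyUpTo suc (nth (x ∷ xs)) (length xs) ⟩
  applyUpTo (nth xs) (length xs)                  ≡⟨ LP.map-upTo (nth xs) (length xs) ⟨
  map (nth xs) (upTo (length xs))                 ≡⟨ map-nth-upTo xs ⟩
  map just xs                                     ∎)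
  where open ≡-Reasoning

toList-lookup : ∀ (v : Vec A n) → toList v ≡ tabulate (V.lookup v)
toList-lookup V.[]      = refl
toList-lookup (x V.∷ v) = cong (x ∷_) (toList-lookup v)

nth-toList : ∀ (v : Vec A n) (j : Fin n) → nth (toList v) (toℕ j) ≡ just (V.lookup v j)
nth-toList (x V.∷ v) Fin.zero    = refl
nth-toList (x V.∷ v) (Fin.suc j) = nth-toList v j

map-≡⇒≡ : ∀ (f g : A → A′) {xs x} → map f xs ≡ map g xs → x ∈ xs → f x ≡ g x
map-≡⇒≡ f g {_ ∷ _} eq (here refl) = LP.∷-injectiveˡ eq
map-≡⇒≡ f g {_ ∷ _} eq (there x∈)  = map-≡⇒≡ f g (LP.∷-injectiveʳ eq) x∈

<∣>≡just⇒ : ∀ (m m′ : Maybe A) {x} → (m <∣> m′) ≡ just x → m ≡ just x ⊎ (m ≡ nothing × m′ ≡ just x)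
<∣>≡just⇒ (just _) _ h = inj₁ h
<∣>≡just⇒ nothing  _ h = inj₂ (refl , h)

length-filter-map : ∀ {P : A′ → Set} (P? : Decidable P) (g : A → A′) xs →
  length (filter P? (map g xs)) ≡ length (filter (P? ∘ g) xs)
length-filter-map P? g []       = refl
length-filter-map P? g (x ∷ xs) with does (P? (g x))
... | true  = cong suc (length-filter-map P? g xs)
... | false = length-filter-map P? g xs

length-filter-concatMap : ∀ {P : A′ → Set} (P? : Decidable P) (f : A → List A′) xs →
  length (filter P? (concatMap f xs)) ≡ sum (map (length ∘ filter P? ∘ f) xs)
length-filter-concatMap P? f []       = refl
length-filter-concatMap P? f (x ∷ xs) = begin
  length (filter P? (f x ++ concatMap f xs))                      ≡⟨ cong length (LP.filter-++ P? (f x) _) ⟩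
  length (filter P? (f x) ++ filter P? (concatMap f xs))          ≡⟨ LP.length-++ (filter P? (f x)) ⟩
  length (filter P? (f x)) + length (filter P? (concatMap f xs))  ≡⟨ cong (_ +_) (length-filter-concatMap P? f xs) ⟩
  sum (map (length ∘ filter P? ∘ f) (x ∷ xs))                     ∎
  where open ≡-Reasoning

sum-map-indicator : ∀ {P : A → Set} (P? : Decidable P) K (g : A → ℕ) →
  (∀ x → g x ≡ (if does (P? x) then K else 0)) → ∀ xs → sum (map g xs) ≡ length (filter P? xs) * K
sum-map-indicator P? K g hg []       = refl
sum-map-indicator P? K g hg (x ∷ xs) rewrite hg x with does (P? x)
... | true  = cong (K +_) (sum-map-indicator P? K g hg xs)
... | false = sum-map-indicator P? K g hg xs

filter-applyUpTo-prefix : ∀ {P : A → Set} (P? : Decidable P) (f : ℕ → A) n m →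
  (∀ r → P (f r) ⇔ r < m) → filter P? (applyUpTo f n) ≡ applyUpTo f (n ⊓ m)
filter-applyUpTo-prefix P? f n zero h rewrite ⊓-zeroʳ n =
  LP.filter-none P? (All.applyUpTo⁺₁ f n λ {r} _ p → n≮0 (to (h r) p))
filter-applyUpTo-prefix P? f zero (suc m) h = refl
filter-applyUpTo-prefix P? f (suc n) (suc m) h =
  trans (LP.filter-accept P? (from (h 0) z<s))
        (cong (f 0 ∷_) (filter-applyUpTo-prefix P? (f ∘ suc) n m λ r →
          mk⇔ (≤-pred ∘ to (h (suc r))) (from (h (suc r)) ∘ s<s)))

length-filter-tabulate-interval : ∀ {n} {P : A → Set} (P? : Decidable P) (f : Fin n → A) lo hi →
  (∀ x → P (f x) ⇔ (lo ≤ toℕ x × toℕ x < hi)) → length (filter P? (tabulate f)) ≡ (n ⊓ hi) ∸ lo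
length-filter-tabulate-interval {n = zero} P? f lo hi h = sym (0∸n≡0 lo)
length-filter-tabulate-interval {n = suc n} P? f lo zero h =
  trans (cong length (LP.filter-none P? (All.tabulate⁺ λ x p → n≮0 (proj₂ (to (h x) p))))) (sym (0∸n≡0 lo))
length-filter-tabulate-interval {n = suc n} P? f zero (suc hi) h =
  trans (cong length (LP.filter-accept P? (from (h Fin.zero) (z≤n , z<s))))
        (cong suc (length-filter-tabulate-interval P? (f ∘ Fin.suc) zero hi λ x →
          mk⇔ (λ p → z≤n , ≤-pred (proj₂ (to (h (Fin.suc x)) p)))
              (λ (_ , x<hi) → from (h (Fin.suc x)) (z≤n , s<s x<hi))))
length-filter-tabulate-interval {n = suc n} P? f (suc lo) (suc hi) h =
  trans (cong length (LP.filter-reject P? λ p → n≮0 (proj₁ (to (h Fin.zero) p))))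
        (length-filter-tabulate-interval P? (f ∘ Fin.suc) lo hi λ x →
          mk⇔ (Product.map ≤-pred ≤-pred ∘ to (h (Fin.suc x))) (from (h (Fin.suc x)) ∘ Product.map s≤s s<s))

≤-leadingRun⇒ : ∀ (p : ℕ → Bool) xs {d} → d ≤ leadingRun p xs → ∀ r → r < d → Any (T ∘ p) (nth xs r)
≤-leadingRun⇒ p []       d≤0 r r<d with () ← <-≤-trans r<d d≤0
≤-leadingRun⇒ p (x ∷ xs) d≤ zero r<d with p x in px
... | true  = just (subst T (sym px) _)
... | false with () ← <-≤-trans r<d d≤
≤-leadingRun⇒ p (x ∷ xs) {suc d} d≤ (suc r) (s<s r<d) with p x
... | true  = ≤-leadingRun⇒ p xs (≤-pred d≤) r r<d
... | false with () ← d≤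

≤-leadingRun⇐ : ∀ (p : ℕ → Bool) xs d → (∀ r → r < d → Any (T ∘ p) (nth xs r)) → d ≤ leadingRun p xs
≤-leadingRun⇐ p xs       zero    _ = z≤n
≤-leadingRun⇐ p []       (suc d) h with () ← h 0 z<s
≤-leadingRun⇐ p (x ∷ xs) (suc d) h with just px ← h 0 z<s | p x
... | true  = s≤s (≤-leadingRun⇐ p xs d (λ r → h (suc r) ∘ s<s))
... | false = ⊥-elim px

-- Streets and the pullback rule

below : ℕ → ℕ → List ℕ
below zero    m       = []
below (suc a) zero    = []
below (suc a) (suc m) = a ∷ below a m

above : ℕ → ℕ → List ℕ
above a zero    = []
above a (suc f) = suc a ∷ above (suc a) f

applyUpTo-below : ∀ a m → applyUpTo (λ r → a ∸ suc r) (m ⊓ a) ≡ below a m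
applyUpTo-below zero    m rewrite ⊓-zeroʳ m = refl
applyUpTo-below (suc a) zero    = refl
applyUpTo-below (suc a) (suc m) = cong (a ∷_) (applyUpTo-below a m)

applyUpTo-above : ∀ a f {g : ℕ → ℕ} → (∀ r → g r ≡ a + suc r) → applyUpTo g f ≡ above a f
applyUpTo-above a zero    _  = refl
applyUpTo-above a (suc f) hg = cong₂ _∷_ (trans (hg 0) (+-comm a 1))
  (applyUpTo-above (suc a) f λ r → trans (hg (suc r)) (+-suc a (suc r)))

+-suc≤⇔<∸ : ∀ a t {r} → a + suc r ≤ t ⇔ r < t ∸ a
+-suc≤⇔<∸ zero    t       = mk⇔ id id
+-suc≤⇔<∸ (suc a) zero    = mk⇔ (λ ()) (λ ())
+-suc≤⇔<∸ (suc a) (suc t) = mk⇔ (to (+-suc≤⇔<∸ a t) ∘ ≤-pred) (s≤s ∘ from (+-suc≤⇔<∸ a t))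

candidates-below : ∀ a k → map (a ∸_) (filter (_≤? a) (oneTo k)) ≡ below a k
candidates-below a k = begin
  map (a ∸_) (filter (_≤? a) (map suc (upTo k)))  ≡⟨ cong (map (a ∸_) ∘ filter (_≤? a)) (LP.map-upTo suc k) ⟩
  map (a ∸_) (filter (_≤? a) (applyUpTo suc k))
    ≡⟨ cong (map (a ∸_)) (filter-applyUpTo-prefix _ suc k a λ _ → mk⇔ id id) ⟩
  map (a ∸_) (applyUpTo suc (k ⊓ a))              ≡⟨ LP.map-applyUpTo suc (a ∸_) (k ⊓ a) ⟩
  applyUpTo (λ r → a ∸ suc r) (k ⊓ a)             ≡⟨ applyUpTo-below a k ⟩
  below a k                                       ∎
  where open ≡-Reasoning

candidates-above : ∀ t a ℓ → filter (_≤? t) (map (a +_) (oneTo ℓ)) ≡ above a (ℓ ⊓ (t ∸ a))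
candidates-above t a ℓ = begin
  filter (_≤? t) (map (a +_) (map suc (upTo ℓ)))  ≡⟨ cong (filter (_≤? t) ∘ map (a +_)) (LP.map-upTo suc ℓ) ⟩
  filter (_≤? t) (map (a +_) (applyUpTo suc ℓ))   ≡⟨ cong (filter (_≤? t)) (LP.map-applyUpTo suc (a +_) ℓ) ⟩
  filter (_≤? t) (applyUpTo (λ r → a + suc r) ℓ)
    ≡⟨ filter-applyUpTo-prefix _ _ ℓ (t ∸ a) (λ _ → +-suc≤⇔<∸ a t) ⟩
  applyUpTo (λ r → a + suc r) (ℓ ⊓ (t ∸ a))       ≡⟨ applyUpTo-above a _ (λ _ → refl) ⟩
  above a (ℓ ⊓ (t ∸ a))                           ∎
  where open ≡-Reasoning

candidates-≤ : ∀ k ℓ t {a} → a ≤ t → All (_≤ t) (candidates k ℓ t a)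
candidates-≤ k ℓ t {a} a≤t = a≤t All.∷ All.++⁺
  (All.map⁺ (All.universal (λ r → ≤-trans (m∸n≤m a r) a≤t) (filter (_≤? a) (oneTo k))))
  (All.all-filter (_≤? t) (map (a +_) (oneTo ℓ)))

place-same : ∀ st s c → place st s c s ≡ just c
place-same st s c rewrite to T-≡ (≡⇒≡ᵇ s s refl) = refl

place-other : ∀ st {s u} c → u ≢ s → place st s c u ≡ st u
place-other st {s} {u} c u≢s with u ≡ᵇ s in eq
... | true  = contradiction (≡ᵇ⇒≡ u s (from T-≡ eq)) u≢s
... | false = refl

Occupied Vacant : Street → ℕ → Set
Occupied st u = Is-just (st u)
Vacant   st u = st u ≡ nothing

Filled : Street → ℕ → ℕ → Set
Filled st lo hi = ∀ {u} → lo ≤ u → u < hi → Occupied st u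

data Landing (st : Street) (k ℓ a i : ℕ) : Set where
  at-preference : a ≡ i → Landing st k ℓ a i
  backward      : i < a → a ≤ i + k → Filled st (suc i) (suc a) → Landing st k ℓ a i
  forward       : a < i → i ≤ a + ℓ → Filled st (a ∸ k) i → Landing st k ℓ a i

RightRun LeftRun : Street → ℕ → ℕ → Set
RightRun st i R = ∀ d → d ≤ R ⇔ Filled st (suc i) (suc i + d)
LeftRun  st i L = ∀ d → d ≤ L ⇔ Filled st (i ∸ d) i

_≟ᴹ_ : DecidableEquality (Maybe ℕ)
_≟ᴹ_ = MP.≡-dec _≟_

#landingAt : Street → (k ℓ t i : ℕ) → ℕ
#landingAt st k ℓ t i = length (filter (λ x → firstEmpty st (candidates k ℓ t (suc (toℕ x))) ≟ᴹ just i) (allFin t))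

m∸[[m∸n]+o]≡n∸o : ∀ {m n} o → n ≤ m → m ∸ ((m ∸ n) + o) ≡ n ∸ o
m∸[[m∸n]+o]≡n∸o {m} {n} o n≤m = trans (sym (∸-+-assoc m (m ∸ n) o)) (cong (_∸ o) (m∸[m∸n]≡n n≤m))

0<m≤o∸n⇒m+n≤o : ∀ {m n o} → 0 < m → m ≤ o ∸ n → m + n ≤ o
0<m≤o∸n⇒m+n≤o {m} 0<m m≤o∸n =
  m≤o∸n⇒m+n≤o m (<⇒≤ (m∸n≢0⇒n<m λ o∸n≡0 → <⇒≱ 0<m (subst (m ≤_) o∸n≡0 m≤o∸n))) m≤o∸n

window-size : ∀ j f b → f ≤ j → suc j + b ∸ (j ∸ f) ≡ b + f + 1
window-size j f b f≤j = begin
  suc j + b ∸ d        ≡⟨ cong (λ n → suc n + b ∸ d) (m∸n+n≡m f≤j) ⟨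
  suc (d + f) + b ∸ d  ≡⟨ cong (_∸ d) (rearrange d f b) ⟩
  d + (b + f + 1) ∸ d  ≡⟨ m+n∸m≡n d (b + f + 1) ⟩
  b + f + 1            ∎
  where
  open ≡-Reasoning
  open +-*-Solver using (solve; _:=_; _:+_; con)
  d = j ∸ f
  rearrange : ∀ d f b → suc (d + f) + b ≡ d + (b + f + 1)
  rearrange = solve 3 (λ d f b → con 1 :+ (d :+ f) :+ b := d :+ (b :+ f :+ con 1)) refl

module _ {st : Street} where

  vacant-or-occupied : ∀ u → Vacant st u ⊎ Occupied st u
  vacant-or-occupied u with st u
  ... | nothing = inj₁ refl
  ... | just _  = inj₂ (just _)

  vacant⇒¬occupied : ∀ {u} → Vacant st u → ¬ Occupied st u
  vacant⇒¬occupied v o with () ← subst Is-just v o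

  Filled-empty : ∀ {lo hi} → hi ≤ lo → Filled st lo hi
  Filled-empty hi≤lo lo≤u u<hi = contradiction (≤-trans hi≤lo lo≤u) (<⇒≱ u<hi)

  Filled-weaken : ∀ {lo lo′ hi hi′} → lo ≤ lo′ → hi′ ≤ hi → Filled st lo hi → Filled st lo′ hi′
  Filled-weaken lo≤ ≤hi filled lo′≤u u<hi′ = filled (≤-trans lo≤ lo′≤u) (<-≤-trans u<hi′ ≤hi)

  Filled-++ : ∀ {lo mid hi} → Filled st lo mid → Filled st mid hi → Filled st lo hi
  Filled-++ {mid = mid} left right {u} lo≤u u<hi with u <? mid
  ... | yes u<mid = left lo≤u u<mid
  ... | no  u≮mid = right (≮⇒≥ u≮mid) u<hi

  Filled-∷ : ∀ {lo hi} → Occupied st lo → Filled st (suc lo) hi → Filled st lo hi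
  Filled-∷ o filled lo≤u u<hi with m≤n⇒m<n∨m≡n lo≤u
  ... | inj₁ lo<u = filled lo<u u<hi
  ... | inj₂ refl = o

  Filled-∷ʳ : ∀ {lo hi} → Filled st lo hi → Occupied st hi → Filled st lo (suc hi)
  Filled-∷ʳ filled o lo≤u u<hi with m≤n⇒m<n∨m≡n (≤-pred u<hi)
  ... | inj₁ u<hi′ = filled lo≤u u<hi′
  ... | inj₂ refl  = o

  Filled-up⇔ : ∀ lo d → Filled st lo (lo + d) ⇔ (∀ r → r < d → Occupied st (lo + r))
  Filled-up⇔ lo d = mk⇔
    (λ filled r r<d → filled (m≤m+n lo r) (+-monoʳ-< lo r<d))
    (λ h {u} lo≤u u<lo+d → let lo+r≡u = m+[n∸m]≡n lo≤u in
      subst (Occupied st) lo+r≡u (h (u ∸ lo) (+-cancelˡ-< lo _ _ (subst (_< lo + d) (sym lo+r≡u) u<lo+d))))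

  -- For d > suc j both sides also require spot 0 to be occupied.
  Filled-down⇔ : ∀ j d → Filled st (suc j ∸ d) (suc j) ⇔ (∀ r → r < d → Occupied st (j ∸ r))
  Filled-down⇔ j d = mk⇔
    (λ filled r r<d → filled (∸-monoʳ-≤ (suc j) r<d) (s≤s (m∸n≤m j r)))
    (λ h {u} lo≤u u<1+j → let u≤j = ≤-pred u<1+j in
      subst (Occupied st) (m∸[m∸n]≡n u≤j) (h (j ∸ u) (subst (_≤ d) (+-∸-assoc 1 u≤j)
        (m≤n+o⇒m∸n≤o (suc j) u (subst (suc j ≤_) (+-comm d u)
          (≤-trans (m≤n+m∸n (suc j) d) (+-monoʳ-≤ d lo≤u)))))))

  firstEmpty-vacant : ∀ {x} xs → Vacant st x → firstEmpty st (x ∷ xs) ≡ just x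
  firstEmpty-vacant _ v rewrite v = refl

  firstEmpty-occupied : ∀ {x} xs → Occupied st x → firstEmpty st (x ∷ xs) ≡ firstEmpty st xs
  firstEmpty-occupied {x} _ o with st x
  ... | just _ = refl

  firstEmpty-∷⇒ : ∀ x xs {s} → firstEmpty st (x ∷ xs) ≡ just s →
    (x ≡ s × Vacant st x) ⊎ (Occupied st x × firstEmpty st xs ≡ just s)
  firstEmpty-∷⇒ x xs h with st x
  ... | nothing = inj₁ (MP.just-injective h , refl)
  ... | just _  = inj₂ (just _ , h)

  firstEmpty-++ : ∀ xs ys → firstEmpty st (xs ++ ys) ≡ firstEmpty st xs <∣> firstEmpty st ys
  firstEmpty-++ []       ys = refl
  firstEmpty-++ (x ∷ xs) ys with st x
  ... | nothing = refl
  ... | just _  = firstEmpty-++ xs ys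

  firstEmpty-∈ : ∀ xs {s} → firstEmpty st xs ≡ just s → s ∈ xs
  firstEmpty-∈ (x ∷ xs) h with firstEmpty-∷⇒ x xs h
  ... | inj₁ (refl , _) = here refl
  ... | inj₂ (_ , h′)   = there (firstEmpty-∈ xs h′)

  firstEmpty⇒vacant : ∀ xs {s} → firstEmpty st xs ≡ just s → Vacant st s
  firstEmpty⇒vacant (x ∷ xs) h with firstEmpty-∷⇒ x xs h
  ... | inj₁ (refl , v) = v
  ... | inj₂ (_ , h′)   = firstEmpty⇒vacant xs h′

  below-hit⇒ : ∀ a m {s} → firstEmpty st (below a m) ≡ just s → s < a × a ≤ s + m × Filled st (suc s) a
  below-hit⇒ (suc a) (suc m) h with firstEmpty-∷⇒ a (below a m) h
  ... | inj₁ (refl , _) = ≤-refl , ≤-trans (m≤m+n (suc a) m) (≤-reflexive (sym (+-suc a m))) , Filled-empty ≤-refl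
  ... | inj₂ (o , h′) with s<a , a≤s+m , filled ← below-hit⇒ a m h′ =
    m<n⇒m<1+n s<a , ≤-trans (s≤s a≤s+m) (≤-reflexive (sym (+-suc _ m))) , Filled-∷ʳ filled o

  below-hit⇐ : ∀ a m {s} → s < a → a ≤ s + m → Vacant st s → Filled st (suc s) a →
    firstEmpty st (below a m) ≡ just s
  below-hit⇐ (suc a) zero    {s} s<a a≤s+0 _ _ = contradiction (subst (suc a ≤_) (+-identityʳ s) a≤s+0) (<⇒≱ s<a)
  below-hit⇐ (suc a) (suc m) {s} s<a a≤s+m v filled with m≤n⇒m<n∨m≡n (≤-pred s<a)
  ... | inj₂ refl = firstEmpty-vacant (below a m) v
  ... | inj₁ s<a′ = trans (firstEmpty-occupied (below a m) (filled s<a′ ≤-refl))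
    (below-hit⇐ a m s<a′ (≤-pred (subst (suc a ≤_) (+-suc s m) a≤s+m)) v (Filled-weaken ≤-refl (n≤1+n a) filled))

  below-miss⇒ : ∀ a m → firstEmpty st (below a m) ≡ nothing → Filled st (a ∸ m) a
  below-miss⇒ zero    m       _ = Filled-empty z≤n
  below-miss⇒ (suc a) zero    _ = Filled-empty ≤-refl
  below-miss⇒ (suc a) (suc m) h with vacant-or-occupied a
  ... | inj₁ v with () ← trans (sym (firstEmpty-vacant (below a m) v)) h
  ... | inj₂ o = Filled-∷ʳ (below-miss⇒ a m (trans (sym (firstEmpty-occupied (below a m) o)) h)) o

  below-miss⇐ : ∀ a m → Filled st (a ∸ m) a → firstEmpty st (below a m) ≡ nothing
  below-miss⇐ zero    m       _      = refl
  below-miss⇐ (suc a) zero    _      = refl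
  below-miss⇐ (suc a) (suc m) filled = trans (firstEmpty-occupied (below a m) (filled (m∸n≤m a m) ≤-refl))
    (below-miss⇐ a m (Filled-weaken ≤-refl (n≤1+n a) filled))

  above-hit⇒ : ∀ a f {s} → firstEmpty st (above a f) ≡ just s → a < s × s ≤ a + f × Filled st (suc a) s
  above-hit⇒ a (suc f) h with firstEmpty-∷⇒ (suc a) (above (suc a) f) h
  ... | inj₁ (refl , _) = ≤-refl , ≤-trans (m≤m+n (suc a) f) (≤-reflexive (sym (+-suc a f))) , Filled-empty ≤-refl
  ... | inj₂ (o , h′) with a<s , s≤a+f , filled ← above-hit⇒ (suc a) f h′ =
    <⇒≤ a<s , ≤-trans s≤a+f (≤-reflexive (sym (+-suc a f))) , Filled-∷ o filled

  above-hit⇐ : ∀ a f {s} → a < s → s ≤ a + f → Vacant st s → Filled st (suc a) s →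
    firstEmpty st (above a f) ≡ just s
  above-hit⇐ a zero    a<s s≤a+0 _ _ = contradiction (subst (_ ≤_) (+-identityʳ a) s≤a+0) (<⇒≱ a<s)
  above-hit⇐ a (suc f) a<s s≤a+f v filled with m≤n⇒m<n∨m≡n a<s
  ... | inj₂ refl = firstEmpty-vacant (above (suc a) f) v
  ... | inj₁ a<s′ = trans (firstEmpty-occupied (above (suc a) f) (filled ≤-refl a<s′))
    (above-hit⇐ (suc a) f a<s′ (≤-trans s≤a+f (≤-reflexive (+-suc a f))) v (Filled-weaken (n≤1+n _) ≤-refl filled))

  firstEmpty-candidates-occupied : ∀ k ℓ t {a} → Occupied st a →
    firstEmpty st (candidates k ℓ t a) ≡ firstEmpty st (below a k) <∣> firstEmpty st (above a (ℓ ⊓ (t ∸ a)))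
  firstEmpty-candidates-occupied k ℓ t {a} o = begin
    firstEmpty st (candidates k ℓ t a)
      ≡⟨ firstEmpty-occupied (drop 1 (candidates k ℓ t a)) o ⟩
    firstEmpty st (map (a ∸_) (filter (_≤? a) (oneTo k)) ++ filter (_≤? t) (map (a +_) (oneTo ℓ)))
      ≡⟨ cong₂ (λ xs ys → firstEmpty st (xs ++ ys)) (candidates-below a k) (candidates-above t a ℓ) ⟩
    firstEmpty st (below a k ++ above a (ℓ ⊓ (t ∸ a)))
      ≡⟨ firstEmpty-++ (below a k) _ ⟩
    firstEmpty st (below a k) <∣> firstEmpty st (above a (ℓ ⊓ (t ∸ a)))
      ∎
    where open ≡-Reasoning

  landing⇒ : ∀ k ℓ t a {i} → firstEmpty st (candidates k ℓ t a) ≡ just i → Landing st k ℓ a i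
  landing⇒ k ℓ t a h with firstEmpty-∷⇒ a (drop 1 (candidates k ℓ t a)) h
  ... | inj₁ (a≡i , _) = at-preference a≡i
  ... | inj₂ (o , _) with <∣>≡just⇒ _ _ (trans (sym (firstEmpty-candidates-occupied k ℓ t o)) h)
  ...   | inj₁ hit with i<a , a≤i+k , filled ← below-hit⇒ a k hit = backward i<a a≤i+k (Filled-∷ʳ filled o)
  ...   | inj₂ (miss , hit) with a<i , i≤ , filled ← above-hit⇒ a _ hit =
    forward a<i (≤-trans i≤ (+-monoʳ-≤ a (m⊓n≤m ℓ _))) (Filled-++ (Filled-∷ʳ (below-miss⇒ a k miss) o) filled)

  landing⇐ : ∀ k ℓ t a {i} → i ≤ t → Vacant st i → Landing st k ℓ a i →
    firstEmpty st (candidates k ℓ t a) ≡ just i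
  landing⇐ k ℓ t a _ v (at-preference refl) = firstEmpty-vacant (drop 1 (candidates k ℓ t a)) v
  landing⇐ k ℓ t a _ v (backward i<a a≤i+k filled) =
    trans (firstEmpty-candidates-occupied k ℓ t (filled i<a ≤-refl))
          (cong (_<∣> _) (below-hit⇐ a k i<a a≤i+k v (Filled-weaken ≤-refl (n≤1+n a) filled)))
  landing⇐ k ℓ t a {i} i≤t v (forward a<i i≤a+ℓ filled) =
    trans (firstEmpty-candidates-occupied k ℓ t (filled (m∸n≤m a k) a<i))
          (trans (cong (_<∣> _) (below-miss⇐ a k (Filled-weaken ≤-refl (<⇒≤ a<i) filled)))
                 (above-hit⇐ a _ a<i i≤ v (Filled-weaken (≤-trans (m∸n≤m a k) (n≤1+n a)) ≤-refl filled)))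
    where
    i≤ : i ≤ a + ℓ ⊓ (t ∸ a)
    i≤ = subst (i ≤_) (sym (+-distribˡ-⊓ a ℓ (t ∸ a))) (⊓-glb i≤a+ℓ (≤-trans i≤t (m≤n+m∸n t a)))

  module _ {i R L : ℕ} (right : RightRun st i R) (left : LeftRun st i L) (k ℓ : ℕ) where

    landing⇒window : ∀ {a} → Landing st k ℓ a i → i ≤ a + (L ∸ k) ⊓ ℓ × a ≤ i + R ⊓ k
    landing⇒window {a} (at-preference refl) = m≤m+n a _ , m≤m+n a _
    landing⇒window {a} (backward i<a a≤i+k filled) = ≤-trans (<⇒≤ i<a) (m≤m+n a _) , a≤i+B
      where
      i+d≡a = m+[n∸m]≡n (<⇒≤ i<a)
      d≤R   = from (right (a ∸ i)) (subst (Filled st (suc i) ∘ suc) (sym i+d≡a) filled)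
      a≤i+B = subst (_≤ i + R ⊓ k) i+d≡a (+-monoʳ-≤ i (⊓-glb d≤R (m≤n+o⇒m∸n≤o a i a≤i+k)))
    landing⇒window {a} (forward a<i i≤a+ℓ filled) = i≤a+F , ≤-trans (<⇒≤ a<i) (m≤m+n i _)
      where
      a+d≡i = m+[n∸m]≡n (<⇒≤ a<i)
      d+k≤L = from (left (i ∸ a + k))
                (subst (λ lo → Filled st lo i) (sym (m∸[[m∸n]+o]≡n∸o k (<⇒≤ a<i))) filled)
      i≤a+F = subst (_≤ a + (L ∸ k) ⊓ ℓ) a+d≡i
                (+-monoʳ-≤ a (⊓-glb (m+n≤o⇒m≤o∸n (i ∸ a) d+k≤L) (m≤n+o⇒m∸n≤o i a i≤a+ℓ)))

    window⇒landing : ∀ {a} → i ≤ a + (L ∸ k) ⊓ ℓ → a ≤ i + R ⊓ k → Landing st k ℓ a i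
    window⇒landing {a} i≤a+F a≤i+B with <-cmp a i
    ... | tri≈ _ a≡i _ = at-preference a≡i
    ... | tri> _ _ i<a = backward i<a (≤-trans a≤i+B (+-monoʳ-≤ i (m⊓n≤n R k)))
      (subst (Filled st (suc i) ∘ suc) (m+[n∸m]≡n (<⇒≤ i<a)) (to (right (a ∸ i)) (m≤n⊓o⇒m≤n R k d≤B)))
      where d≤B = m≤n+o⇒m∸n≤o a i a≤i+B
    ... | tri< a<i _ _ = forward a<i (≤-trans i≤a+F (+-monoʳ-≤ a (m⊓n≤n (L ∸ k) ℓ)))
      (subst (λ lo → Filled st lo i) (m∸[[m∸n]+o]≡n∸o k (<⇒≤ a<i))
        (to (left (i ∸ a + k)) (0<m≤o∸n⇒m+n≤o (m<n⇒0<n∸m a<i) (m≤n⊓o⇒m≤n (L ∸ k) ℓ d≤F))))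
      where d≤F = m≤n+o⇒m∸n≤o i a i≤a+F

  RightRun⇒≤ : ∀ {i R t} → RightRun st i R → i ≤ t → Vacant st (suc t) → i + R ≤ t
  RightRun⇒≤ {i} {R} right i≤t v =
    ≮⇒≥ λ t<i+R → vacant⇒¬occupied v (to (right R) ≤-refl (s≤s i≤t) (s≤s t<i+R))

  LeftRun⇒< : ∀ {i L} → LeftRun st i L → 0 < i → Vacant st 0 → L < i
  LeftRun⇒< {i} left 0<i v = ≰⇒> λ i≤L → vacant⇒¬occupied v (to (left i) i≤L (≤-reflexive (n∸n≡0 i)) 0<i)

  landing-count : ∀ k ℓ t {j R L} → suc j ≤ t → Vacant st 0 → Vacant st (suc t) → Vacant st (suc j) →
    RightRun st (suc j) R → LeftRun st (suc j) L → #landingAt st k ℓ t (suc j) ≡ R ⊓ k + (L ∸ k) ⊓ ℓ + 1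
  landing-count k ℓ t {j} {R} {L} i≤t v₀ vₜ vᵢ right left = begin
    #landingAt st k ℓ t (suc j)  ≡⟨ length-filter-tabulate-interval _ id (j ∸ f) (suc j + b) lands⇔window ⟩
    t ⊓ (suc j + b) ∸ (j ∸ f)    ≡⟨ cong (_∸ (j ∸ f)) (m≥n⇒m⊓n≡n window≤t) ⟩
    suc j + b ∸ (j ∸ f)          ≡⟨ window-size j f b f≤j ⟩
    b + f + 1                    ∎
    where
    open ≡-Reasoning
    b = R ⊓ k
    f = (L ∸ k) ⊓ ℓ
    window≤t : suc j + b ≤ t
    window≤t = ≤-trans (+-monoʳ-≤ (suc j) (m⊓n≤m R k)) (RightRun⇒≤ right i≤t vₜ)
    f≤j : f ≤ j
    f≤j = ≤-pred (≤-<-trans (≤-trans (m⊓n≤m _ ℓ) (m∸n≤m L k)) (LeftRun⇒< left z<s v₀))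
    lands⇔window : ∀ x → firstEmpty st (candidates k ℓ t (suc (toℕ x))) ≡ just (suc j)
                       ⇔ (j ∸ f ≤ toℕ x × toℕ x < suc j + b)
    lands⇔window x = mk⇔
      (λ h → let lo , hi = landing⇒window right left k ℓ (landing⇒ k ℓ t _ h)
             in m≤n+o⇒m∸n≤o j f (subst (j ≤_) (+-comm (toℕ x) f) (≤-pred lo)) , hi)
      (λ (lo , hi) → landing⇐ k ℓ t _ i≤t vᵢ (window⇒landing right left k ℓ
        (s≤s (subst (j ≤_) (+-comm f (toℕ x)) (≤-trans (m≤n+m∸n j f) (+-monoʳ-≤ f lo)))) hi))

parkAll-preserves : ∀ k ℓ t st cas {stf u x} → parkAll k ℓ t st cas ≡ just stf → st u ≡ just x → stf u ≡ just x
parkAll-preserves k ℓ t st []              refl stu = stu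
parkAll-preserves k ℓ t st ((c , a) ∷ cas) {u = u} h stu with firstEmpty st (candidates k ℓ t a) in eq
... | nothing      with () ← h
... | just zero    with () ← h
... | just (suc s) = parkAll-preserves k ℓ t (place st (suc s) c) cas h (trans (place-other st c u≢s) stu)
  where
  u≢s : u ≢ suc s
  u≢s refl with () ← trans (sym stu) (firstEmpty⇒vacant (candidates k ℓ t a) eq)

-- Counting preference lists

module Counting (k ℓ t : ℕ) (target : List (Maybe ℕ)) where

  Succeeds : Street → List (ℕ × ℕ) → Set
  Succeeds st cas = M.map (λ st → map st (oneTo t)) (parkAll k ℓ t st cas) ≡ just target

  succeeds? : ∀ st cas → Dec (Succeeds st cas)
  succeeds? st cas = MP.≡-dec (LP.≡-dec _≟ᴹ_) _ _

  prefs : Vec (Fin t) n → List ℕ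
  prefs p = map (λ i → suc (toℕ i)) (toList p)

  -- countPF k ℓ T π unfolds to count emptyStreet T.
  count : Street → Vec ℕ n → ℕ
  count {n} st cs = length (filter (succeeds? st ∘ zip (toList cs) ∘ prefs) (allVecs n t))

  countAfter : Street → ℕ → Vec ℕ n → Maybe ℕ → ℕ
  countAfter st c cs (just (suc s)) = count (place st (suc s) c) cs
  countAfter st c cs _              = 0

  count-[] : ∀ st → map st (oneTo t) ≡ target → count st V.[] ≡ 1
  count-[] st eq = cong length (LP.filter-accept (λ _ → succeeds? st []) (cong just eq))

  count-∷ : ∀ st c {n} (cs : Vec ℕ n) →
    count st (c V.∷ cs)
      ≡ sum (map (λ x → countAfter st c cs (firstEmpty st (candidates k ℓ t (suc (toℕ x))))) (allFin t))
  count-∷ st c {n} cs =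
    trans (length-filter-concatMap _ (λ x → map (x V.∷_) (allVecs n t)) (allFin t))
          (cong sum (LP.map-cong (λ x → trans (length-filter-map _ (x V.∷_) (allVecs n t)) (first-car x)) (allFin t)))
    where
    first-car : ∀ x → length (filter (succeeds? st ∘ zip (toList (c V.∷ cs)) ∘ prefs ∘ (x V.∷_)) (allVecs n t))
                      ≡ countAfter st c cs (firstEmpty st (candidates k ℓ t (suc (toℕ x))))
    first-car x with firstEmpty st (candidates k ℓ t (suc (toℕ x)))
    ... | nothing      = cong length (LP.filter-none _ {allVecs n t} (All.universal (λ _ ()) (allVecs n t)))
    ... | just zero    = cong length (LP.filter-none _ {allVecs n t} (All.universal (λ _ ()) (allVecs n t)))
    ... | just (suc s) = refl

  count-blocked : ∀ st {n} (cs : Vec ℕ n) {u x} → st u ≡ just x →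
    (∀ stf → map stf (oneTo t) ≡ target → stf u ≢ just x) → count st cs ≡ 0
  count-blocked st {n} cs {u} {x} stu forbidden = cong length (LP.filter-none (succeeds? st ∘ zip (toList cs) ∘ prefs)
    (All.universal (ruled-out ∘ zip (toList cs) ∘ prefs) (allVecs n t)))
    where
    ruled-out : ∀ cas → ¬ Succeeds st cas
    ruled-out cas h with parkAll k ℓ t st cas in eq
    ... | just stf = forbidden stf (MP.just-injective h) (parkAll-preserves k ℓ t st cas eq stu)

  count-∷-one-spot : ∀ st c {n} (cs : Vec ℕ n) {j K} → count (place st (suc j) c) cs ≡ K →
    (∀ s → s < t → s ≢ j → count (place st (suc s) c) cs ≡ 0) →
    count st (c V.∷ cs) ≡ #landingAt st k ℓ t (suc j) * K
  count-∷-one-spot st c cs {j} {K} correct misplaced =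
    trans (count-∷ st c cs) (sum-map-indicator _ K _ (λ x → by-landing-spot _ (bound x)) (allFin t))
    where
    bound : ∀ x {s} → firstEmpty st (candidates k ℓ t (suc (toℕ x))) ≡ just s → s ≤ t
    bound x h = All.lookup (candidates-≤ k ℓ t (Fin.toℕ<n x)) (firstEmpty-∈ _ h)
    by-landing-spot : ∀ m → (∀ {s} → m ≡ just s → s ≤ t) →
      countAfter st c cs m ≡ (if does (m ≟ᴹ just (suc j)) then K else 0)
    by-landing-spot nothing        _ = refl
    by-landing-spot (just zero)    _ = refl
    by-landing-spot (just (suc s)) s≤t with s ≟ j
    ... | yes refl rewrite dec-true (just (suc s) ≟ᴹ just (suc s)) refl = correct
    ... | no s≢j   rewrite dec-false (just (suc s) ≟ᴹ just (suc j)) (s≢j ∘ suc-injective ∘ MP.just-injective) =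
      misplaced s (s≤t refl) s≢j

-- The street just before each car of T enters

-- Junk (the last position) when c does not occur in v.
indexOf : ℕ → Vec ℕ (suc n) → Fin (suc n)
indexOf c (x V.∷ V.[])    = Fin.zero
indexOf c (x V.∷ y V.∷ v) = if x ≡ᵇ c then Fin.zero else Fin.suc (indexOf c (y V.∷ v))

lookup-indexOf : ∀ (v : Vec ℕ (suc n)) {c} → c ∈ toList v → V.lookup v (indexOf c v) ≡ c
lookup-indexOf (x V.∷ V.[])    (here refl) = refl
lookup-indexOf (x V.∷ y V.∷ v) {c} c∈ with x ≡ᵇ c in eq | c∈
... | true  | _         = ≡ᵇ⇒≡ x c (from T-≡ eq)
... | false | here refl = ⊥-elim (subst T eq (≡⇒≡ᵇ x x refl))
... | false | there c∈′ = lookup-indexOf (y V.∷ v) c∈′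

indexOf-lookup : ∀ (v : Vec ℕ (suc n)) → AllPairs _≢_ (toList v) → ∀ j → indexOf (V.lookup v j) v ≡ j
indexOf-lookup (x V.∷ V.[])    _         Fin.zero    = refl
indexOf-lookup (x V.∷ y V.∷ v) _         Fin.zero    rewrite to T-≡ (≡⇒≡ᵇ x x refl) = refl
indexOf-lookup (x V.∷ y V.∷ v) (x∉ ∷ ds) (Fin.suc j) with x ≡ᵇ V.lookup (y V.∷ v) j in eq
... | true  = contradiction (≡ᵇ⇒≡ x _ (from T-≡ eq)) (All.lookup x∉ (nth-∈ _ (toℕ j) (nth-toList (y V.∷ v) j)))
... | false = cong Fin.suc (indexOf-lookup (y V.∷ v) ds j)

module Outcome (k ℓ t′ : ℕ) (π : Vec ℕ (suc t′))
               (distinct : AllPairs _≢_ (toList π)) (positive : All (0 <_) (toList π)) where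

  t : ℕ
  t = suc t′

  cars : List ℕ
  cars = toList π

  open Counting k ℓ t (map just cars)

  finalStreet : Street
  finalStreet zero    = nothing
  finalStreet (suc u) = nth cars u

  arrived : List ℕ → ℕ → Maybe ℕ
  arrived pending x = if does (x ∈? pending) then nothing else just x

  arrived-∈ : ∀ {pending x} → x ∈ pending → arrived pending x ≡ nothing
  arrived-∈ {pending} {x} x∈ = cong (if_then nothing else just x) (dec-true (x ∈? pending) x∈)

  arrived-∉ : ∀ {pending x} → x ∉ pending → arrived pending x ≡ just x
  arrived-∉ {pending} {x} x∉ = cong (if_then nothing else just x) (dec-false (x ∈? pending) x∉)

  streetBefore : List ℕ → Street
  streetBefore pending u = finalStreet u >>= arrived pending

  record Pending (pending : List ℕ) : Set where
    field
      sorted          : AllPairs _<_ pending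
      entered-smaller : ∀ {x} → x ∈ cars → x ∉ pending → All (x <_) pending

  finalStreet-∈ : ∀ u {x} → finalStreet u ≡ just x → x ∈ cars
  finalStreet-∈ (suc u) = nth-∈ cars u

  map-finalStreet : map finalStreet (oneTo t) ≡ map just cars
  map-finalStreet = begin
    map finalStreet (map suc (upTo t))   ≡⟨ LP.map-∘ (upTo t) ⟨
    map (nth cars) (upTo t)              ≡⟨ cong (map (nth cars) ∘ upTo) (V.length-toList π) ⟨
    map (nth cars) (upTo (length cars))  ≡⟨ map-nth-upTo cars ⟩
    map just cars                        ∎
    where open ≡-Reasoning

  emptyStreet≗streetBefore : ∀ {pending} → (∀ {x} → x ∈ cars → x ∈ pending) →
    emptyStreet ≗ streetBefore pending
  emptyStreet≗streetBefore cars⊆ u with finalStreet u in eq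
  ... | nothing = refl
  ... | just x  = sym (arrived-∈ (cars⊆ (finalStreet-∈ u eq)))

  count-streetBefore-[] : ∀ st → st ≗ streetBefore [] → count st V.[] ≡ 1
  count-streetBefore-[] st inv =
    count-[] st (trans (LP.map-cong (λ u → trans (inv u) (all-arrived u)) (oneTo t)) map-finalStreet)
    where
    all-arrived : ∀ u → streetBefore [] u ≡ finalStreet u
    all-arrived u with finalStreet u
    ... | nothing = refl
    ... | just _  = refl

  module Step {c : ℕ} {cs : List ℕ} {st : Street} (inv : st ≗ streetBefore (c ∷ cs)) (pending : Pending (c ∷ cs))
              (j : Fin t) (π-j≡c : V.lookup π j ≡ c) where
    open Pending pending

    jₙ i : ℕ
    jₙ = toℕ j
    i  = suc jₙ

    finalStreet-i : finalStreet i ≡ just c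
    finalStreet-i = trans (nth-toList π j) (cong just π-j≡c)

    c-only-at-i : ∀ u → finalStreet u ≡ just c → u ≡ i
    c-only-at-i (suc u) eq = cong suc (nth-injective distinct u jₙ eq finalStreet-i)

    c<cs : All (c <_) cs
    c<cs with c<cs ∷ _ ← sorted = c<cs

    c∉cs : c ∉ cs
    c∉cs c∈ = <-irrefl refl (All.lookup c<cs c∈)

    pending-≥ : ∀ {x} → x ∈ c ∷ cs → c ≤ x
    pending-≥ (here refl) = ≤-refl
    pending-≥ (there x∈)  = <⇒≤ (All.lookup c<cs x∈)

    arrived⇔ : ∀ {x} → x ∈ cars → Is-just (arrived (c ∷ cs) x) ⇔ x < c
    arrived⇔ {x} x∈cars with x ∈? (c ∷ cs)
    ... | yes x∈ rewrite arrived-∈ x∈ = mk⇔ (λ ()) (λ x<c → contradiction (pending-≥ x∈) (<⇒≱ x<c))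
    ... | no  x∉ rewrite arrived-∉ x∉ = mk⇔ (λ _ → All.head (entered-smaller x∈cars x∉)) (λ _ → just _)

    occupied⇔ : ∀ u → Occupied st u ⇔ Any (_< c) (finalStreet u)
    occupied⇔ u = subst (λ m → Is-just m ⇔ Any (_< c) (finalStreet u)) (sym (inv u)) (arrival⇔ (finalStreet u) refl)
      where
      arrival⇔ : ∀ m → finalStreet u ≡ m → Is-just (m >>= arrived (c ∷ cs)) ⇔ Any (_< c) m
      arrival⇔ nothing  _  = mk⇔ (λ ()) (λ ())
      arrival⇔ (just x) eq = mk⇔ (just ∘ to (arrived⇔ x∈)) (from (arrived⇔ x∈) ∘ drop-just)
        where x∈ = finalStreet-∈ u eq

    vacant-0 : Vacant st 0
    vacant-0 = inv 0

    vacant-end : Vacant st (suc t)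
    vacant-end = trans (inv (suc t)) (cong (_>>= arrived (c ∷ cs)) (nth-≥ cars (≤-reflexive (V.length-toList π))))

    vacant-i : Vacant st i
    vacant-i = trans (inv i) (trans (cong (_>>= arrived (c ∷ cs)) finalStreet-i) (arrived-∈ {c ∷ cs} (here refl)))

    below-c⇔ : ∀ m → Any (T ∘ (_<ᵇ V.lookup π j)) m ⇔ Any (_< c) m
    below-c⇔ m = mk⇔ (Any.map λ {x} x<ᵇ → subst (x <_) π-j≡c (<ᵇ⇒< x _ x<ᵇ))
                     (Any.map λ {x} x<c → <⇒<ᵇ (subst (x <_) (sym π-j≡c) x<c))

    carBelowᵇ : ℕ → Bool
    carBelowᵇ z = (0 <ᵇ z) ∧ (z <ᵇ V.lookup π j)

    car-below-c⇔ : ∀ m → (∀ {x} → m ≡ just x → x ∈ cars) → Any (T ∘ carBelowᵇ) m ⇔ Any (_< c) m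
    car-below-c⇔ nothing  _   = mk⇔ (λ ()) (λ ())
    car-below-c⇔ (just x) car = mk⇔
      (λ { (just p) → to (below-c⇔ (just x)) (just (proj₂ (to T-∧ p))) })
      (λ x<c → just (from T-∧ (<⇒<ᵇ (All.lookup positive (car refl)) , drop-just (from (below-c⇔ (just x)) x<c))))

    right-cell⇔ : ∀ r → Any (T ∘ (_<ᵇ V.lookup π j)) (nth (drop i cars) r) ⇔ Occupied st (suc i + r)
    right-cell⇔ r = subst (λ m → Any _ m ⇔ Occupied st (suc i + r)) (sym (nth-drop i cars r))
      (mk⇔ (from (occupied⇔ (suc i + r)) ∘ to (below-c⇔ _)) (from (below-c⇔ _) ∘ to (occupied⇔ (suc i + r))))

    right-run : RightRun st i (Right π j)
    right-run d = mk⇔ run⇒filled filled⇒run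
      where
      run⇒filled : d ≤ Right π j → Filled st (suc i) (suc i + d)
      run⇒filled d≤R = from (Filled-up⇔ {st = st} (suc i) d) λ r r<d →
        to (right-cell⇔ r) (≤-leadingRun⇒ _ (drop i cars) d≤R r r<d)
      filled⇒run : Filled st (suc i) (suc i + d) → d ≤ Right π j
      filled⇒run filled = ≤-leadingRun⇐ _ (drop i cars) d λ r r<d →
        from (right-cell⇔ r) (to (Filled-up⇔ {st = st} (suc i) d) filled r r<d)

    prefix : List ℕ
    prefix = 0 ∷ take jₙ cars

    length-prefix : length prefix ≡ i
    length-prefix = cong suc (trans (LP.length-take jₙ cars)
      (m≤n⇒m⊓n≡m (≤-trans (<⇒≤ (Fin.toℕ<n j)) (≤-reflexive (sym (V.length-toList π))))))

    prefix-cell⇔ : ∀ u → u ≤ jₙ → Any (T ∘ carBelowᵇ) (nth prefix u) ⇔ Occupied st u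
    prefix-cell⇔ zero    _    = mk⇔ (λ { (just ()) }) (λ o → contradiction o (vacant⇒¬occupied {st = st} vacant-0))
    prefix-cell⇔ (suc u) u<jₙ = subst (λ m → Any _ m ⇔ Occupied st (suc u)) (sym (nth-take jₙ cars u<jₙ))
      (mk⇔ (from (occupied⇔ (suc u)) ∘ to (car-below-c⇔ _ (nth-∈ cars u)))
           (from (car-below-c⇔ _ (nth-∈ cars u)) ∘ to (occupied⇔ (suc u))))

    left-cell⇔ : ∀ r → Any (T ∘ carBelowᵇ) (nth (reverse prefix) r) ⇔ Occupied st (jₙ ∸ r)
    left-cell⇔ r with r <? i
    ... | yes r<i = subst (λ m → Any _ m ⇔ Occupied st (jₙ ∸ r))
      (sym (trans (nth-reverse prefix (subst (r <_) (sym length-prefix) r<i))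
                  (cong (λ n → nth prefix (n ∸ suc r)) length-prefix)))
      (prefix-cell⇔ (jₙ ∸ r) (m∸n≤m jₙ r))
    ... | no  r≮i = subst (λ m → Any _ m ⇔ Occupied st (jₙ ∸ r))
      (sym (nth-≥ (reverse prefix)
             (≤-trans (≤-reflexive (trans (LP.length-reverse prefix) length-prefix)) (≮⇒≥ r≮i))))
      (mk⇔ (λ ()) (λ o → contradiction (subst (Occupied st) (m≤n⇒m∸n≡0 (<⇒≤ (≮⇒≥ r≮i))) o)
                                       (vacant⇒¬occupied {st = st} vacant-0)))

    left-run : LeftRun st i (Left π j)
    left-run d = mk⇔ run⇒filled filled⇒run
      where
      run⇒filled : d ≤ Left π j → Filled st (i ∸ d) i
      run⇒filled d≤L = from (Filled-down⇔ {st = st} jₙ d) λ r r<d →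
        to (left-cell⇔ r) (≤-leadingRun⇒ _ (reverse prefix) d≤L r r<d)
      filled⇒run : Filled st (i ∸ d) i → d ≤ Left π j
      filled⇒run filled = ≤-leadingRun⇐ _ (reverse prefix) d λ r r<d →
        from (left-cell⇔ r) (to (Filled-down⇔ {st = st} jₙ d) filled r r<d)

    pending-rest : Pending cs
    pending-rest = record { sorted = sorted-rest ; entered-smaller = entered-smaller-rest }
      where
      sorted-rest : AllPairs _<_ cs
      sorted-rest with _ ∷ s ← sorted = s
      entered-smaller-rest : ∀ {x} → x ∈ cars → x ∉ cs → All (x <_) cs
      entered-smaller-rest {x} x∈cars x∉cs with x ≟ c
      ... | yes refl = c<cs
      ... | no  x≢c  = All.tail (entered-smaller x∈cars λ { (here x≡c) → x≢c x≡c ; (there x∈) → x∉cs x∈ })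

    arrived-rest : ∀ {x} → x ≢ c → arrived (c ∷ cs) x ≡ arrived cs x
    arrived-rest {x} x≢c = by-membership (x ∈? cs)
      where
      by-membership : Dec (x ∈ cs) → arrived (c ∷ cs) x ≡ arrived cs x
      by-membership (yes x∈) = trans (arrived-∈ {c ∷ cs} (there x∈)) (sym (arrived-∈ x∈))
      by-membership (no  x∉) =
        trans (arrived-∉ {c ∷ cs} λ { (here x≡c) → x≢c x≡c ; (there x∈) → x∉ x∈ }) (sym (arrived-∉ x∉))

    place-step : place st i c ≗ streetBefore cs
    place-step u with u ≟ i
    ... | yes refl = trans (place-same st i c) (sym (trans (cong (_>>= arrived cs) finalStreet-i) (arrived-∉ c∉cs)))
    ... | no  u≢i  = trans (place-other st c u≢i) (trans (inv u) (unchanged (finalStreet u) refl))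
      where
      unchanged : ∀ m → finalStreet u ≡ m → (m >>= arrived (c ∷ cs)) ≡ (m >>= arrived cs)
      unchanged nothing  _  = refl
      unchanged (just x) eq = arrived-rest λ { refl → u≢i (c-only-at-i u eq) }

    misplaced : ∀ s → s < t → s ≢ jₙ → ∀ {n} (cs′ : Vec ℕ n) → count (place st (suc s) c) cs′ ≡ 0
    misplaced s s<t s≢j cs′ = count-blocked (place st (suc s) c) cs′ (place-same st (suc s) c) λ stf final stf≡c →
      let stf≡final = map-≡⇒≡ stf finalStreet (trans final (sym map-finalStreet)) (∈-map⁺ suc (∈-upTo⁺ s<t))
      in s≢j (suc-injective (c-only-at-i (suc s) (trans (sym stf≡final) stf≡c)))

  factor : ℕ → ℕ
  factor c = B k π (indexOf c π) + F k ℓ π (indexOf c π) + 1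

  count-streetBefore : ∀ {n} (cs : Vec ℕ n) → Pending (toList cs) → All (_∈ cars) (toList cs) →
    ∀ st → st ≗ streetBefore (toList cs) → count st cs ≡ product (map factor (toList cs))
  count-streetBefore V.[]        _       _              st inv = count-streetBefore-[] st inv
  count-streetBefore (c V.∷ cs) pending (c∈ All.∷ cs∈) st inv = begin
    count st (c V.∷ cs)        ≡⟨ count-∷-one-spot st c cs rest (λ s s<t s≢j → misplaced s s<t s≢j cs) ⟩
    #landingAt st k ℓ t i * K
      ≡⟨ cong (_* K) (landing-count k ℓ t (Fin.toℕ<n j) vacant-0 vacant-end vacant-i right-run left-run) ⟩
    factor c * K               ∎
    where
    open ≡-Reasoning
    j = indexOf c π
    open Step inv pending j (lookup-indexOf π c∈)
    K = product (map factor (toList cs))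
    rest = count-streetBefore cs pending-rest cs∈ (place st i c) place-step

  map-factor-cars : map factor cars ≡ map (λ j → B k π j + F k ℓ π j + 1) (allFin t)
  map-factor-cars = begin
    map factor cars                                 ≡⟨ cong (map factor) (toList-lookup π) ⟩
    map factor (tabulate (V.lookup π))              ≡⟨ LP.map-tabulate (V.lookup π) factor ⟩
    tabulate (factor ∘ V.lookup π)                  ≡⟨ LP.tabulate-cong (cong factorAt ∘ indexOf-lookup π distinct) ⟩
    tabulate factorAt                               ≡⟨ LP.map-tabulate id factorAt ⟨
    map factorAt (allFin t)                         ∎
    where
    open ≡-Reasoning
    factorAt : Fin t → ℕ
    factorAt j = B k π j + F k ℓ π j + 1

lemma3p10 : (k ℓ t : ℕ) → 1 ≤ t → (T : Vec ℕ t) →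
    Linked _<_ (toList T) → All (0 <_) (toList T) →
    (π : Vec ℕ t) → toList π ↭ toList T →
    countPF k ℓ T π ≡ productFormula k ℓ π
lemma3p10 k ℓ (suc t′) _ T increasing positive π π↭T = begin
  countPF k ℓ T π                  ≡⟨ count-streetBefore T pending-T T⊆cars emptyStreet start ⟩
  product (map factor (toList T))  ≡⟨ product-↭ (↭.map⁺ factor (↭-sym π↭T)) ⟩
  product (map factor cars)        ≡⟨ cong product map-factor-cars ⟩
  productFormula k ℓ π             ∎
  where
  open ≡-Reasoning
  sorted : AllPairs _<_ (toList T)
  sorted = Linked⇒AllPairs <-trans increasing
  distinct : AllPairs _≢_ (toList π)
  distinct = ↭ₛ.Unique-resp-↭ (setoid ℕ) (↭⇒↭ₛ (↭-sym π↭T)) (AllPairs.map <⇒≢ sorted)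
  open Outcome k ℓ t′ π distinct (↭.All-resp-↭ (↭-sym π↭T) positive)
  T⊆cars : All (_∈ cars) (toList T)
  T⊆cars = All.tabulate (↭.∈-resp-↭ (↭-sym π↭T))
  pending-T : Pending (toList T)
  pending-T = record
    { sorted          = sorted
    ; entered-smaller = λ x∈cars x∉T → contradiction (↭.∈-resp-↭ π↭T x∈cars) x∉T
    }
  start : emptyStreet ≗ streetBefore (toList T)
  start = emptyStreet≗streetBefore (↭.∈-resp-↭ π↭T)
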